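{- Let $G=(V,E)$ be a connected graph (loops allowed) with a multi-chain ordering $L_0,\dots,L_z$, with vertices in each layer ordered as described in the context, let $H$ be a graph (loops allowed) with vertex set $C$, and let $\mathcal P$ be a list mapping of $G$ (so $\mathcal P(x)\subseteq C$ for each $x\in V$). Assume $H$ has no universal vertex. Then $G$ has a homomorphism to $H$ obeying $\mathcal P$ if and only if the configuration graph contains a directed path from $S_0$ to $S_{z+1}$.
   Context: Graphs are finite without multiple edges, loops allowed. A homomorphism $\chi:G\to H$ is a map $V(G)\to V(H)$ with $\chi(x)\chi(y)\in E(H)$ whenever $xy\in E(G)$; it obeys $\mathcal P$ if $\chi(x)\in\mathcal P(x)$ for all $x$. A vertex $c$ of $H$ is universal if $c$ is adjacent to every vertex of $H$, including itself (has a loop). A chain graph is a bipartite graph with no induced $2K_2$. The multi-chain ordering: $v_0\in V$, $L_i$ is the set of vertices at distance $i$ from $v_0$ ($L_0=\{v_0\}$, $z$ maximal with $L_z\ne\emptyset$), and for each $0\le i<z$ the bipartite graph formed by the edges of $G$ between $L_i$ and $L_{i+1}$ is a chain graph. For $x\in L_i$, $d_-(x)$ is the number of neighbours of $x$ in $L_{i-1}$ ($0$ if $i=0$) and $d_+(x)$ the number of neighbours of $x$ in $L_{i+1}$ ($0$ if $i=z$). The vertices of each layer are ordered by decreasing $d_-$ (ties broken arbitrarily); consequently the neighbours of $x\in L_i$ in $L_{i+1}$ are exactly the first $d_+(x)$ vertices of $L_{i+1}$. A configuration is a pair $(i,B)$ with $1\le i\le z$ and $B:C\to\{0,1,\dots,|L_i|\}$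 such that $B$ takes both the value $0$ and the value $|L_i|$; in addition there are two special configurations $S_0=(0,B_0)$ and $S_{z+1}=(z+1,B_0)$ where $B_0\equiv 0$ on $C$. The configuration graph is the directed graph on all configurations with an edge from $(i,B)$ to $(i',B')$ iff $i'=i+1$ and there is a homomorphism $\chi$ from the subgraph $G_i$ of $G$ induced by $L_i$ to $H$ such that: (1) $\chi(x)\in\mathcal P(x)$ for all $x\in L_i$; (2) for each $c\in C$, $\chi$ does not assign $c$ to any of the first $B(c)$ vertices of $L_i$; (3) for each $x\in L_i$ and each $c\in C$ not adjacent to $\chi(x)$ in $H$, $B'(c)\ge d_+(x)$. -}

module Defs where

open import Data.Nat using (ℕ; zero; suc; _≤_; _<_)
open import Data.Bool using (Bool; true; false)
open import Data.Fin using (Fin; toℕ)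
open import Data.Fin.Subset using (Subset) renaming (_∈_ to _∈ₛ_)
open import Data.List using (List; []; _∷_; length; lookup)
open import Data.List.Membership.Propositional using (_∈_)
open import Data.List.Relation.Unary.Unique.Propositional using (Unique)
open import Data.List.Relation.Unary.Linked using (Linked)
open import Data.Product using (_×_; _,_; Σ; ∃; ∃-syntax)
open import Data.Sum using (_⊎_)
open import Relation.Nullary using (¬_)
open import Relation.Binary.PropositionalEquality using (_≡_; _≢_)
open import Function.Bundles using (_⇔_)

-- A finite graph on vertex set Fin n, loops allowed, no multiple edges:
-- a symmetric Boolean adjacency relation (adj x x = true means a loop at x).
record Graph (n : ℕ) : Set where
  field
    adj : Fin n → Fin n → Bool
    adj-sym : ∀ x y → adj x y ≡ adj y x

open Graph public

Edge : ∀ {n} → Graph n → Fin n → Fin n → Set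
Edge G x y = adj G x y ≡ true

data Walk {n} (G : Graph n) : Fin n → Fin n → ℕ → Set where
  here : ∀ {x} → Walk G x x zero
  step : ∀ {x y w ℓ} → Edge G x y → Walk G y w ℓ → Walk G x w (suc ℓ)

Connected : ∀ {n} → Graph n → Set
Connected G = ∀ x y → ∃[ ℓ ] Walk G x y ℓ

Dist : ∀ {n} → Graph n → Fin n → Fin n → ℕ → Set
Dist G x y i = Walk G x y i × (∀ j → j < i → ¬ Walk G x y j)

Universal : ∀ {k} → Graph k → Fin k → Set
Universal H c = ∀ d → Edge H c d

IsHom : ∀ {n k} → Graph n → Graph k → (Fin n → Fin k) → Set
IsHom G H χ = ∀ x y → Edge G x y → Edge H (χ x) (χ y)

Obeys : ∀ {n k} → (Fin n → Subset k) → (Fin n → Fin k) → Set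
Obeys P χ = ∀ x → χ x ∈ₛ P x

count : ∀ {A : Set} → (A → Bool) → List A → ℕ
count p [] = zero
count p (a ∷ as) with p a
... | true  = suc (count p as)
... | false = count p as

-- Bipartite graph with sides X, Y and edge relation E (only X–Y edges
-- count) is a chain graph: no induced 2K₂, i.e. no distinct a,c ∈ X and
-- distinct b,d ∈ Y with ab, cd edges and ad, cb non-edges.
IsChainGraph : ∀ {n} → (X Y : Fin n → Set) → (Fin n → Fin n → Set) → Set
IsChainGraph X Y E =
  ¬ (Σ _ λ a → Σ _ λ b → Σ _ λ c → Σ _ λ d →
       X a × Y b × X c × Y d × a ≢ c × b ≢ d ×
       E a b × E c d × ¬ E a d × ¬ E c b)

module Layers {n : ℕ} (G : Graph n) (v₀ : Fin n) (ord : ℕ → List (Fin n)) where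

  L : ℕ → Fin n → Set
  L i x = Dist G v₀ x i

  -- ord i lists the vertices of L i in the chosen order.
  -- d₋ and d₊ count neighbours in the previous / next layer
  -- (ord (suc z) is necessarily empty, so d₊ = 0 on L z).
  d₋ : ℕ → Fin n → ℕ
  d₋ zero x = zero
  d₋ (suc i) x = count (adj G x) (ord i)

  d₊ : ℕ → Fin n → ℕ
  d₊ i x = count (adj G x) (ord (suc i))

  ∣L∣ : ℕ → ℕ
  ∣L∣ i = length (ord i)

record MultiChainOrdering {n} (G : Graph n) (v₀ : Fin n) (z : ℕ)
                          (ord : ℕ → List (Fin n)) : Set where
  open Layers G v₀ ord
  field
    top-nonempty : ∃[ x ] L z x
    top-maximal  : ∀ i x → L i x → i ≤ z
    chain        : ∀ i → i < z → IsChainGraph (L i) (L (suc i)) (Edge G)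
    ord-unique   : ∀ i → Unique (ord i)
    ord-complete : ∀ i x → (x ∈ ord i ⇔ L i x)
    ord-sorted   : ∀ i → Linked (λ x y → d₋ i y ≤ d₋ i x) (ord i)

module ConfigurationGraph {n k : ℕ} (G : Graph n) (H : Graph k)
         (P : Fin n → Subset k) (v₀ : Fin n) (z : ℕ)
         (ord : ℕ → List (Fin n)) where
  open Layers G v₀ ord

  Cfg : Set
  Cfg = ℕ × (Fin k → ℕ)

  B₀ : Fin k → ℕ
  B₀ _ = zero

  S₀ : Cfg
  S₀ = zero , B₀

  Sₑ : Cfg
  Sₑ = suc z , B₀

  IsConfig : Cfg → Set
  IsConfig (i , B) =
      (i ≡ zero × (∀ c → B c ≡ zero))
    ⊎ (i ≡ suc z × (∀ c → B c ≡ zero))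
    ⊎ (1 ≤ i × i ≤ z × (∀ c → B c ≤ ∣L∣ i)
         × (∃[ c ] B c ≡ zero) × (∃[ c ] B c ≡ ∣L∣ i))

  CfgEdge : Cfg → Cfg → Set
  CfgEdge (i , B) (i' , B') =
    IsConfig (i , B) × IsConfig (i' , B') × i' ≡ suc i ×
    Σ (Fin n → Fin k) λ χ →
        (∀ x y → L i x → L i y → Edge G x y → Edge H (χ x) (χ y))
      × (∀ x → L i x → χ x ∈ₛ P x)
      × (∀ c (p : Fin (∣L∣ i)) → toℕ p < B c → χ (lookup (ord i) p) ≢ c)
      × (∀ x c → L i x → adj H (χ x) c ≡ false → d₊ i x ≤ B' c)

module Submission where

-- Forward: from a homomorphism χ, let B_{i+1}(c) be the largest d₊(x) over the
-- x ∈ L_i with χ(x) not adjacent to c.  Because every x ∈ L_i sees an initial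
-- segment of L_{i+1}, the first B_{i+1}(c) vertices of L_{i+1} are all adjacent
-- to some such x and hence are not coloured c; B_{i+1} vanishes at the colour
-- of the first vertex of L_{i+1}, and it reaches |L_{i+1}| at any colour missed
-- by χ(w), where w is a predecessor of the last vertex of L_{i+1} (such a
-- colour exists as H has no universal vertex).
-- Backward: a path S₀ → S_{z+1} supplies one colouring per layer; the edges
-- inside a layer are respected by construction, and an edge xy between L_i and
-- L_{i+1} is respected because y sits among the first d₊(x) vertices of
-- L_{i+1}, so condition (3) at layer i and condition (2) at layer i+1 forbid
-- χ(y) from being a non-neighbour of χ(x).

open import Defs
open import Data.Bool using (Bool; true; false; if_then_else_) renaming (_≟_ to _≟ᵇ_)
open import Data.Bool.Properties using (¬-not)
open import Data.Empty using (⊥-elim)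
open import Data.Fin using (Fin; toℕ; fromℕ) renaming (zero to fzero; suc to fsuc)
open import Data.Fin.Properties using (¬∀⟶∃¬; toℕ-fromℕ) renaming (_≟_ to _≟ᶠ_)
open import Data.Fin.Subset using (Subset) renaming (_∈_ to _∈ₛ_)
open import Data.List using (List; []; _∷_; length; lookup; map)
open import Data.List.Extrema.Nat using (max; max≤v⁺; v≤max⁺)
open import Data.List.Membership.Propositional using (_∈_; find)
open import Data.List.Membership.Propositional.Properties using (∈-lookup)
import Data.List.Relation.Unary.All as All
import Data.List.Relation.Unary.All.Properties as All
open import Data.List.Relation.Unary.AllPairs using (AllPairs; _∷_)
open import Data.List.Relation.Unary.Any as Any using (here; there; index)
open import Data.List.Relation.Unary.Any.Properties as Any using (lookup-index)
open import Data.List.Relation.Unary.Linked.Properties using (Linked⇒AllPairs)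
open import Data.Nat using (ℕ; zero; suc; _+_; _∸_; _≤_; _<_; z≤n; s≤s; _≤?_; _<?_)
open import Data.Nat.Induction using (<-rec)
open import Data.Nat.Properties
open import Data.Product using (Σ; ∃-syntax; _×_; _,_; proj₁; proj₂)
open import Data.Sum using (_⊎_; inj₁; inj₂)
open import Function using (_∘_)
open import Function.Bundles using (_⇔_; mk⇔; Equivalence)
open import Relation.Binary.Construct.Closure.ReflexiveTransitive using (Star; ε; _◅_)
open import Relation.Binary.Definitions using (tri<; tri≈; tri>)
open import Relation.Binary.PropositionalEquality
open import Relation.Nullary using (¬_; Dec; yes; no; contradiction)
import Relation.Nullary.Decidable as Dec

true≢false : true ≢ false
true≢false ()

module _ {A : Set} where

  count≤length : ∀ f (xs : List A) → count f xs ≤ length xs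
  count≤length f []       = z≤n
  count≤length f (a ∷ xs) with f a
  ... | true  = s≤s (count≤length f xs)
  ... | false = m≤n⇒m≤1+n (count≤length f xs)

  count-mono : ∀ f g (xs : List A) → (∀ {w} → w ∈ xs → f w ≡ true → g w ≡ true) →
               count f xs ≤ count g xs
  count-mono f g []       f⇒g = z≤n
  count-mono f g (a ∷ xs) f⇒g with f a in fa | g a in ga
  ... | true  | true  = s≤s (count-mono f g xs (λ w∈ → f⇒g (there w∈)))
  ... | true  | false = contradiction (trans (sym (f⇒g (here refl) fa)) ga) true≢false
  ... | false | true  = m≤n⇒m≤1+n (count-mono f g xs (λ w∈ → f⇒g (there w∈)))
  ... | false | false = count-mono f g xs (λ w∈ → f⇒g (there w∈))

  count-mono-< : ∀ f g (xs : List A) → (∀ {w} → w ∈ xs → f w ≡ true → g w ≡ true) →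
                 ∀ {x} → x ∈ xs → g x ≡ true → f x ≡ false → count f xs < count g xs
  count-mono-< f g (a ∷ xs) f⇒g (here refl) gx fx rewrite gx | fx =
    s≤s (count-mono f g xs (λ w∈ → f⇒g (there w∈)))
  count-mono-< f g (a ∷ xs) f⇒g (there x∈) gx fx with f a in fa | g a in ga
  ... | true  | true  = s≤s (count-mono-< f g xs (λ w∈ → f⇒g (there w∈)) x∈ gx fx)
  ... | true  | false = contradiction (trans (sym (f⇒g (here refl) fa)) ga) true≢false
  ... | false | true  = m≤n⇒m≤1+n (count-mono-< f g xs (λ w∈ → f⇒g (there w∈)) x∈ gx fx)
  ... | false | false = count-mono-< f g xs (λ w∈ → f⇒g (there w∈)) x∈ gx fx

  AllPairs-lookup : ∀ {R : A → A → Set} {xs : List A} → AllPairs R xs →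
                    ∀ (p q : Fin (length xs)) → toℕ p < toℕ q → R (lookup xs p) (lookup xs q)
  AllPairs-lookup (Ra ∷ _)  fzero    (fsuc q) _         = All.lookup Ra (∈-lookup q)
  AllPairs-lookup (_ ∷ Rxs) (fsuc p) (fsuc q) (s≤s p<q) = AllPairs-lookup Rxs p q p<q

  PrefixClosed : (A → Bool) → List A → Set
  PrefixClosed f xs = ∀ (p q : Fin (length xs)) → toℕ p < toℕ q →
                      f (lookup xs q) ≡ true → f (lookup xs p) ≡ true

  prefixClosed-tail : ∀ f a xs → PrefixClosed f (a ∷ xs) → PrefixClosed f xs
  prefixClosed-tail f a xs closed p q p<q = closed (fsuc p) (fsuc q) (s≤s p<q)

  prefixClosed-false : ∀ f a xs → PrefixClosed f (a ∷ xs) → f a ≡ false →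
                       ∀ p → f (lookup (a ∷ xs) p) ≡ false
  prefixClosed-false f a xs closed fa fzero    = fa
  prefixClosed-false f a xs closed fa (fsuc p) =
    ¬-not (λ fp → true≢false (trans (sym (closed fzero (fsuc p) (s≤s z≤n) fp)) fa))

  count-none : ∀ f (xs : List A) → (∀ p → f (lookup xs p) ≡ false) → count f xs ≡ 0
  count-none f []       _    = refl
  count-none f (a ∷ xs) none with f a | none fzero
  ... | false | _ = count-none f xs (none ∘ fsuc)

  prefixClosed⇒holds⇔<count : ∀ f xs → PrefixClosed f xs →
                              ∀ p → f (lookup xs p) ≡ true ⇔ toℕ p < count f xs
  prefixClosed⇒holds⇔<count f (a ∷ xs) closed p with f a in fa
  prefixClosed⇒holds⇔<count f (a ∷ xs) closed fzero    | true =
    mk⇔ (λ _ → s≤s z≤n) (λ _ → fa)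
  prefixClosed⇒holds⇔<count f (a ∷ xs) closed (fsuc p) | true =
    mk⇔ (λ fp → s≤s (to fp)) (λ { (s≤s p<) → from p< })
    where open Equivalence (prefixClosed⇒holds⇔<count f xs (prefixClosed-tail f a xs closed) p)
  ... | false = mk⇔ (λ fp → contradiction (trans (sym fp) (none p)) true≢false)
                    (λ p<0 → contradiction (subst (toℕ p <_) (count-none f xs (none ∘ fsuc)) p<0) n≮0)
    where none = prefixClosed-false f a xs closed fa

  first-position : ∀ {x} {xs : List A} → x ∈ xs → Σ (Fin (length xs)) λ p → toℕ p ≡ 0
  first-position {xs = _ ∷ _} _ = fzero , refl

  last-position : ∀ {x} {xs : List A} → x ∈ xs → Σ (Fin (length xs)) λ p → suc (toℕ p) ≡ length xs
  last-position {xs = _ ∷ as} _ = fromℕ (length as) , cong suc (toℕ-fromℕ (length as))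

  maxOf : (A → ℕ) → List A → ℕ
  maxOf f xs = max 0 (map f xs)

  ≤-maxOf : ∀ f xs {x} → x ∈ xs → f x ≤ maxOf f xs
  ≤-maxOf f xs x∈ = v≤max⁺ 0 (map f xs) (inj₂ (Any.map⁺ (Any.map (λ { refl → ≤-refl }) x∈)))

  maxOf-≤ : ∀ f xs {v} → (∀ {x} → x ∈ xs → f x ≤ v) → maxOf f xs ≤ v
  maxOf-≤ f xs bounded = max≤v⁺ z≤n (All.map⁺ (All.tabulate bounded))

  <-maxOf⇒ : ∀ f xs {v} → v < maxOf f xs → ∃[ x ] x ∈ xs × v < f x
  <-maxOf⇒ f xs {v} v<max with Any.any? (λ x → v <? f x) xs
  ... | yes some = find some
  ... | no none  = contradiction v<max (≤⇒≯ (maxOf-≤ f xs v≮))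
    where
    v≮ : ∀ {x} → x ∈ xs → f x ≤ v
    v≮ x∈ = ≮⇒≥ (λ v<fx → none (Any.map (λ { refl → v<fx }) x∈))

module _ {n} {X Y : Fin n → Set} {E : Fin n → Fin n → Set} where

  chainGraph-nested : IsChainGraph X Y E → (∀ a b → Dec (E a b)) →
                      ∀ {a b c d} → X a → Y b → X c → Y d → b ≢ d →
                      E a b → ¬ E a d → E c d → E c b
  chainGraph-nested chain E? {a} {b} {c} {d} Xa Yb Xc Yd b≢d ab ¬ad cd with E? c b
  ... | yes cb = cb
  ... | no ¬cb = ⊥-elim (chain (a , b , c , d , Xa , Yb , Xc , Yd , a≢c , b≢d , ab , cd , ¬ad , ¬cb))
    where
    a≢c : a ≢ c
    a≢c refl = ¬ad cd

edge-sym : ∀ {n} (G : Graph n) {x y} → Edge G x y → Edge G y x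
edge-sym G {x} {y} e = trans (adj-sym G y x) e

Edge? : ∀ {n} (G : Graph n) a b → Dec (Edge G a b)
Edge? G a b = adj G a b ≟ᵇ true

module _ {n} {G : Graph n} where

  walk-snoc : ∀ {x w y j} → Walk G x w j → Edge G w y → Walk G x y (suc j)
  walk-snoc here         e = step e here
  walk-snoc (step e′ wk) e = step e′ (walk-snoc wk e)

  walk-unsnoc : ∀ {x y j} → Walk G x y (suc j) → ∃[ w ] Walk G x w j × Edge G w y
  walk-unsnoc (step e here) = _ , here , e
  walk-unsnoc (step e (step e′ wk)) with walk-unsnoc (step e′ wk)
  ... | w , wk′ , e″ = w , step e wk′ , e″

module Layering {n} (G : Graph n) (v₀ : Fin n) (z : ℕ) (ord : ℕ → List (Fin n))
                (mco : MultiChainOrdering G v₀ z ord) where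
  open Layers G v₀ ord
  open MultiChainOrdering mco
  open import Data.List.Membership.DecPropositional (_≟ᶠ_ {n}) using (_∈?_)

  ∈ord⇒L : ∀ {i x} → x ∈ ord i → L i x
  ∈ord⇒L {i} {x} = Equivalence.to (ord-complete i x)

  L⇒∈ord : ∀ {i x} → L i x → x ∈ ord i
  L⇒∈ord {i} {x} = Equivalence.from (ord-complete i x)

  L? : ∀ i x → Dec (L i x)
  L? i x = Dec.map (ord-complete i x) (x ∈? ord i)

  L-predecessor : ∀ {i y} → L (suc i) y → ∃[ w ] L i w × Edge G w y
  L-predecessor (wk , shortest) with walk-unsnoc wk
  ... | w , wk′ , e = w , (wk′ , λ j j<i wj → shortest (suc j) (s≤s j<i) (walk-snoc wj e)) , e

  L-edge-≤ : ∀ {i j x y} → L i x → L j y → Edge G x y → j ≤ suc i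
  L-edge-≤ {i} {j} (wx , _) (_ , shortest) e with j ≤? suc i
  ... | yes j≤ = j≤
  ... | no  j≰ = ⊥-elim (shortest (suc i) (≰⇒> j≰) (walk-snoc wx e))

  L-edge : ∀ {i j x y} → L i x → L j y → Edge G x y → i ≡ j ⊎ j ≡ suc i ⊎ i ≡ suc j
  L-edge {i} {j} Lx Ly e with <-cmp i j
  ... | tri≈ _ i≡j _ = inj₁ i≡j
  ... | tri< i<j _ _ = inj₂ (inj₁ (≤-antisym (L-edge-≤ Lx Ly e) i<j))
  ... | tri> _ _ j<i = inj₂ (inj₂ (≤-antisym (L-edge-≤ Ly Lx (edge-sym G e)) j<i))

  L-nonempty : ∀ {i} → i ≤ z → ∃[ x ] L i x
  L-nonempty {i} i≤z = descend (z ∸ i) (m∸n+n≡m i≤z)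
    where
    descend : ∀ m {i} → m + i ≡ z → ∃[ x ] L i x
    descend zero    refl = top-nonempty
    descend (suc m) eq   with descend m (trans (+-suc m _) eq)
    ... | y , Ly = let w , Lw , _ = L-predecessor Ly in w , Lw

  ord-beyond-top : ord (suc z) ≡ []
  ord-beyond-top with ord (suc z) in eq
  ... | []    = refl
  ... | x ∷ _ = contradiction (top-maximal (suc z) x (∈ord⇒L (subst (x ∈_) (sym eq) (here refl))))
                              (n≮n z)

  d₊-top : ∀ x → d₊ z x ≡ 0
  d₊-top x rewrite ord-beyond-top = refl

  unreachable : ∀ {x} → (∀ i → ¬ L i x) → ∀ j → ¬ Walk G v₀ x j
  unreachable ¬L = <-rec _ (λ j shorter wk → ¬L j (wk , λ _ j′<j → shorter j′<j))

  layerOf : Connected G → ∀ x → ∃[ i ] L i x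
  layerOf conn x with anyUpTo? (λ i → L? i x) (suc z)
  ... | yes (i , _ , Lx) = i , Lx
  ... | no  none = ⊥-elim (unreachable ¬L _ (proj₂ (conn v₀ x)))
    where
    ¬L : ∀ i → ¬ L i x
    ¬L i Lx = none (i , s≤s (top-maximal i x Lx) , Lx)

  -- if x sees the q-th vertex of L_{i+1} but not the p-th (p < q), the chain
  -- property makes the neighbourhood of the p-th vertex in L_i a proper subset of
  -- that of the q-th, against the ordering by decreasing d₋
  neighbours-prefixClosed : ∀ {i x} → i < z → L i x → PrefixClosed (adj G x) (ord (suc i))
  neighbours-prefixClosed {i} {x} i<z Lx p q p<q x~yq with Edge? G x (lookup (ord (suc i)) p)
  ... | yes x~yp = x~yp
  ... | no  x≁yp = contradiction sorted (<⇒≱ strict)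
    where
    yp = lookup (ord (suc i)) p
    yq = lookup (ord (suc i)) q

    sorted : d₋ (suc i) yq ≤ d₋ (suc i) yp
    sorted = AllPairs-lookup (Linked⇒AllPairs (λ a b → ≤-trans b a) (ord-sorted (suc i))) p q p<q

    yp≢yq : yp ≢ yq
    yp≢yq = AllPairs-lookup (ord-unique (suc i)) p q p<q

    nested : ∀ {w} → w ∈ ord i → adj G yp w ≡ true → adj G yq w ≡ true
    nested w∈ yp~w = edge-sym G (chainGraph-nested (chain i i<z) (Edge? G)
      Lx (∈ord⇒L (∈-lookup q)) (∈ord⇒L w∈) (∈ord⇒L (∈-lookup p))
      (yp≢yq ∘ sym) x~yq x≁yp (edge-sym G yp~w))

    strict : d₋ (suc i) yp < d₋ (suc i) yq
    strict = count-mono-< (adj G yp) (adj G yq) (ord i) nested (L⇒∈ord Lx)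
               (edge-sym G x~yq) (¬-not (x≁yp ∘ edge-sym G))

  neighbours-prefix : ∀ {i x} → i < z → L i x →
                      ∀ p → Edge G x (lookup (ord (suc i)) p) ⇔ toℕ p < d₊ i x
  neighbours-prefix {i} {x} i<z Lx =
    prefixClosed⇒holds⇔<count (adj G x) (ord (suc i)) (neighbours-prefixClosed i<z Lx)

  module _ {k} (H : Graph k) where

    layered-hom : (conn : Connected G) (Φ : ℕ → Fin n → Fin k) →
                  (∀ {i x y} → L i x → L i y → Edge G x y → Edge H (Φ i x) (Φ i y)) →
                  (∀ {i x y} → L i x → L (suc i) y → Edge G x y → Edge H (Φ i x) (Φ (suc i) y)) →
                  IsHom G H (λ x → Φ (proj₁ (layerOf conn x)) x)
    layered-hom conn Φ within across x y =
      respects (proj₂ (layerOf conn x)) (proj₂ (layerOf conn y))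
      where
      respects : ∀ {i j x y} → L i x → L j y → Edge G x y → Edge H (Φ i x) (Φ j y)
      respects Lx Ly e with L-edge Lx Ly e
      ... | inj₁ refl        = within Lx Ly e
      ... | inj₂ (inj₁ refl) = across Lx Ly e
      ... | inj₂ (inj₂ refl) = edge-sym H (across Ly Lx (edge-sym G e))

module _ {n k} (G : Graph n) (H : Graph k) (P : Fin n → Subset k) (v₀ : Fin n) (z : ℕ)
         (ord : ℕ → List (Fin n)) (mco : MultiChainOrdering G v₀ z ord) where
  open Layers G v₀ ord
  open MultiChainOrdering mco
  open Layering G v₀ z ord mco
  open ConfigurationGraph G H P v₀ z ord

  EdgeWitness : ℕ → (Fin k → ℕ) → (Fin k → ℕ) → (Fin n → Fin k) → Set
  EdgeWitness i B B′ χ =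
      (∀ x y → L i x → L i y → Edge G x y → Edge H (χ x) (χ y))
    × (∀ x → L i x → χ x ∈ₛ P x)
    × (∀ c (p : Fin (∣L∣ i)) → toℕ p < B c → χ (lookup (ord i) p) ≢ c)
    × (∀ x c → L i x → adj H (χ x) c ≡ false → d₊ i x ≤ B′ c)

  witnesses-across : ∀ {i B B′ B″ χ χ′ x y} → i < z →
                     EdgeWitness i B B′ χ → EdgeWitness (suc i) B′ B″ χ′ →
                     L i x → L (suc i) y → Edge G x y → Edge H (χ x) (χ′ y)
  witnesses-across {i} {B′ = B′} {χ = χ} {χ′} {x} {y}
                   i<z (_ , _ , _ , bounded) (_ , _ , avoids , _) Lx Ly x~y
    with Edge? H (χ x) (χ′ y)
  ... | yes χx~χ′y = χx~χ′y
  ... | no  χx≁χ′y = contradiction (cong χ′ (sym y≡)) (avoids (χ′ y) pos (≤-trans pos<d₊ d₊≤B′))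
    where
    y∈ = L⇒∈ord Ly
    pos = index y∈
    y≡ : y ≡ lookup (ord (suc i)) pos
    y≡ = lookup-index y∈
    pos<d₊ : toℕ pos < d₊ i x
    pos<d₊ = Equivalence.to (neighbours-prefix i<z Lx pos) (subst (Edge G x) y≡ x~y)
    d₊≤B′ : d₊ i x ≤ B′ (χ′ y)
    d₊≤B′ = bounded x (χ′ y) Lx (¬-not χx≁χ′y)

  module FromHom (no-universal : ∀ c → ¬ Universal H c)
                 (χ : Fin n → Fin k) (χ-hom : IsHom G H χ) (χ-obeys : Obeys P χ) where

    demand : ℕ → Fin k → Fin n → ℕ
    demand i c x = if adj H (χ x) c then 0 else d₊ i x

    required : ℕ → Fin k → ℕ
    required zero      = B₀
    required (suc i) c = maxOf (demand i c) (ord i)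

    demand≤d₊ : ∀ i c x → demand i c x ≤ d₊ i x
    demand≤d₊ i c x with adj H (χ x) c
    ... | true  = z≤n
    ... | false = ≤-refl

    demand-miss : ∀ {i c x} → adj H (χ x) c ≡ false → demand i c x ≡ d₊ i x
    demand-miss miss rewrite miss = refl

    demand-avoids : ∀ {i c x} → suc i ≤ z → x ∈ ord i →
                    ∀ p → toℕ p < demand i c x → χ (lookup (ord (suc i)) p) ≢ c
    demand-avoids {i} {c} {x} i<z x∈ p p<demand with adj H (χ x) c in miss
    ... | true  = contradiction p<demand n≮0
    ... | false = λ { refl → true≢false (trans (sym (χ-hom _ _ x~y)) miss) }
      where x~y = Equivalence.from (neighbours-prefix i<z (∈ord⇒L x∈) p) p<demand

    d₊≤required : ∀ {i x c} → L i x → adj H (χ x) c ≡ false → d₊ i x ≤ required (suc i) c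
    d₊≤required Lx miss = subst (_≤ _) (demand-miss miss) (≤-maxOf (demand _ _) (ord _) (L⇒∈ord Lx))

    required-avoids : ∀ {i} → i ≤ z → ∀ c p → toℕ p < required i c → χ (lookup (ord i) p) ≢ c
    required-avoids {zero}  _   c p ()
    required-avoids {suc i} i<z c p p<required =
      let x , x∈ , p<demand = <-maxOf⇒ (demand i c) (ord i) p<required
      in  demand-avoids i<z x∈ p p<demand

    required≤∣L∣ : ∀ i c → required (suc i) c ≤ ∣L∣ (suc i)
    required≤∣L∣ i c = maxOf-≤ (demand i c) (ord i)
      (λ {x} _ → ≤-trans (demand≤d₊ i c x) (count≤length (adj G x) (ord (suc i))))

    required-vanishes : ∀ {i} → suc i ≤ z → ∃[ c ] required (suc i) c ≡ 0
    required-vanishes {i} i<z = χ y₁ , n≤0⇒n≡0 (maxOf-≤ (demand i (χ y₁)) (ord i) demand≡0)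
      where
      first = first-position (L⇒∈ord (proj₂ (L-nonempty i<z)))
      y₁ = lookup (ord (suc i)) (proj₁ first)
      demand≡0 : ∀ {x} → x ∈ ord i → demand i (χ y₁) x ≤ 0
      demand≡0 {x} x∈ with 0 <? demand i (χ y₁) x
      ... | no  ¬pos = ≮⇒≥ ¬pos
      ... | yes pos  = contradiction refl (demand-avoids i<z x∈ (proj₁ first)
                         (subst (_< demand i (χ y₁) x) (sym (proj₂ first)) pos))

    required-full : ∀ {i} → suc i ≤ z → ∃[ c ] required (suc i) c ≡ ∣L∣ (suc i)
    required-full {i} i<z =
      c , ≤-antisym (required≤∣L∣ i c) (≤-trans ∣L∣≤d₊w (d₊≤required Lw (¬-not χw≁c)))
      where
      last = last-position (L⇒∈ord (proj₂ (L-nonempty i<z)))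
      predecessor = L-predecessor (∈ord⇒L (∈-lookup (proj₁ last)))
      w = proj₁ predecessor
      Lw = proj₁ (proj₂ predecessor)
      ∣L∣≤d₊w : ∣L∣ (suc i) ≤ d₊ i w
      ∣L∣≤d₊w = subst (_≤ d₊ i w) (proj₂ last)
                  (Equivalence.to (neighbours-prefix i<z Lw (proj₁ last)) (proj₂ (proj₂ predecessor)))
      missed = ¬∀⟶∃¬ k (Edge H (χ w)) (Edge? H (χ w)) (no-universal (χ w))
      c = proj₁ missed
      χw≁c = proj₂ missed

    required-config : ∀ {i} → i ≤ z → IsConfig (i , required i)
    required-config {zero}  _   = inj₁ (refl , λ _ → refl)
    required-config {suc i} i<z =
      inj₂ (inj₂ (s≤s z≤n , i<z , required≤∣L∣ i , required-vanishes i<z , required-full i<z))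

    χ-witnesses : ∀ {i B′} → i ≤ z → (∀ x c → L i x → adj H (χ x) c ≡ false → d₊ i x ≤ B′ c) →
                  EdgeWitness i (required i) B′ χ
    χ-witnesses i≤z bounded =
      (λ x y _ _ → χ-hom x y) , (λ x _ → χ-obeys x) , required-avoids i≤z , bounded

    path-from : ∀ m {i} → m + i ≡ z → Star CfgEdge (i , required i) Sₑ
    path-from zero    refl = last-edge ◅ ε
      where
      last-edge = required-config ≤-refl , inj₂ (inj₁ (refl , λ _ → refl)) , refl , χ ,
                  χ-witnesses ≤-refl (λ x _ _ _ → ≤-reflexive (d₊-top x))
    path-from (suc m) {i} eq = edge ◅ path-from m (trans (+-suc m i) eq)
      where
      i<z : i < z
      i<z = subst (i <_) eq (s≤s (m≤n+m i m))
      edge = required-config (<⇒≤ i<z) , required-config i<z , refl , χ ,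
             χ-witnesses (<⇒≤ i<z) (λ _ _ → d₊≤required)

    path : Star CfgEdge S₀ Sₑ
    path = path-from z (+-identityʳ z)

  module FromPath (c₀ : Fin k) where

    configs : ∀ {s} → Star CfgEdge s Sₑ → ℕ → Fin k → ℕ
    configs {s} _          zero    = proj₂ s
    configs     ε          (suc m) = B₀
    configs     (_ ◅ rest) (suc m) = configs rest m

    -- c₀ fills the layers beyond z, where no witness is available
    colouring : ∀ {s} → Star CfgEdge s Sₑ → ℕ → Fin n → Fin k
    colouring ε                         _       = λ _ → c₀
    colouring ((_ , _ , _ , χ , _) ◅ _) zero    = χ
    colouring (_ ◅ rest)                (suc m) = colouring rest m

    colouring-witnesses : ∀ {i B} (path : Star CfgEdge (i , B) Sₑ) m → m + i ≤ z →
                          EdgeWitness (m + i) (configs path m) (configs path (suc m)) (colouring path m)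
    colouring-witnesses ε m m+i≤z = contradiction (m+n≤o⇒n≤o m m+i≤z) (n≮n z)
    colouring-witnesses ((_ , _ , refl , _ , witness) ◅ _) zero _ = witness
    colouring-witnesses {i} ((_ , _ , refl , _ , _) ◅ rest) (suc m) m+i<z =
      subst (λ j → EdgeWitness j (configs rest m) (configs rest (suc m)) (colouring rest m))
            (+-suc m i) (colouring-witnesses rest m (subst (_≤ z) (sym (+-suc m i)) m+i<z))

  path⇒hom : Connected G → Star CfgEdge S₀ Sₑ → Σ (Fin n → Fin k) λ χ → IsHom G H χ × Obeys P χ
  path⇒hom conn path@((_ , _ , _ , χ₀ , _) ◅ _) = χ , layered-hom H conn Φ within across , obeys
    where
    open FromPath (χ₀ v₀)
    Φ = colouring path
    χ : Fin n → Fin k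
    χ x = Φ (proj₁ (layerOf conn x)) x

    witness : ∀ {i} → i ≤ z → EdgeWitness i (configs path i) (configs path (suc i)) (Φ i)
    witness {i} i≤z =
      subst (λ j → EdgeWitness j (configs path i) (configs path (suc i)) (Φ i))
            (+-identityʳ i) (colouring-witnesses path i (subst (_≤ z) (sym (+-identityʳ i)) i≤z))

    within : ∀ {i x y} → L i x → L i y → Edge G x y → Edge H (Φ i x) (Φ i y)
    within {i} Lx Ly = proj₁ (witness (top-maximal i _ Lx)) _ _ Lx Ly

    across : ∀ {i x y} → L i x → L (suc i) y → Edge G x y → Edge H (Φ i x) (Φ (suc i) y)
    across {i} Lx Ly = witnesses-across i<z (witness (<⇒≤ i<z)) (witness i<z) Lx Ly
      where i<z = top-maximal (suc i) _ Ly

    obeys : Obeys P χ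
    obeys x = let i , Lx = layerOf conn x in proj₁ (proj₂ (witness (top-maximal i x Lx))) x Lx

theorem3 : (n k : ℕ) (G : Graph n) (H : Graph k) (P : Fin n → Subset k)
           (v₀ : Fin n) (z : ℕ) (ord : ℕ → List (Fin n)) →
           Connected G →
           MultiChainOrdering G v₀ z ord →
           (∀ c → ¬ Universal H c) →
           ((Σ (Fin n → Fin k) λ χ → IsHom G H χ × Obeys P χ)
             ⇔ Star (ConfigurationGraph.CfgEdge G H P v₀ z ord)
                    (ConfigurationGraph.S₀ G H P v₀ z ord)
                    (ConfigurationGraph.Sₑ G H P v₀ z ord))
theorem3 n k G H P v₀ z ord conn mco no-universal =
  mk⇔ (λ (χ , χ-hom , χ-obeys) → FromHom.path G H P v₀ z ord mco no-universal χ χ-hom χ-obeys)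
      (path⇒hom G H P v₀ z ord mco conn)
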